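{- Let $q$ be a prime power and $n$ an odd positive integer with $\gcd(n,q)=1$. The multiplier $\mu_{ -q}$ gives a splitting of $n$ over $\mathbb{F}_{q^2}$ if and only if $\gcd(n,q^{2i-1}+1)=1$ for every integer $i\ge1$.
   Context: The $q^2$-cyclotomic coset of $s$ modulo $n$ is $\{s(q^2)^j\bmod n:j\ge0\}$. For $\gcd(b,n)=1$, $\mu_b$ gives a splitting of $n$ over $\mathbb{F}_{q^2}$ if there are sets $S_1,S_2$, each a union of $q^2$-cyclotomic cosets modulo $n$, with $S_1\cup S_2=\{1,\dots,n-1\}$, $S_1\cap S_2=\emptyset$, $bS_1\equiv S_2$ and $bS_2\equiv S_1\pmod n$. -}

module Defs where

open import Data.Nat using (ℕ; suc; _*_; _^_; _≤_; NonZero)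
open import Data.Nat.Primality using (Prime)
open import Data.Integer using (ℤ; +_; _%ℕ_)
import Data.Integer as ℤ
open import Data.Fin using (Fin; toℕ)
open import Data.Fin.Subset using (Subset; _∈_; _∉_)
open import Data.Product using (Σ; ∃; _×_)
open import Data.Sum using (_⊎_)
open import Relation.Binary.PropositionalEquality using (_≡_; _≢_)
open import Relation.Nullary using (¬_)
open import Data.Empty using (⊥)

PrimePower : ℕ → Set
PrimePower q = Σ ℕ λ p → Σ ℕ λ k → Prime p × 1 ≤ k × q ≡ p ^ k

-- Residues modulo n are represented by Fin n; subsets of ℤ/nℤ by Subset n.
-- "the residue class x (a natural number) mod n lies in S"
_∈ℕ_ : {n : ℕ} → ℕ → Subset n → Set
_∈ℕ_ {n} x S = Σ (Fin n) λ i → toℕ i ≡ x × i ∈ S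

InCoset : (q2 n : ℕ) .{{_ : NonZero n}} → ℕ → ℕ → Set
InCoset q2 n s t = ∃ λ j → t ≡ (+ (s * q2 ^ j)) %ℕ n

UnionOfCosets : (q2 n : ℕ) .{{_ : NonZero n}} → Subset n → Set
UnionOfCosets q2 n S = ∀ (s : Fin n) → s ∈ S → ∀ t → InCoset q2 n (toℕ s) t → t ∈ℕ S

MapsOnto : (b : ℤ) (n : ℕ) .{{_ : NonZero n}} → Subset n → Subset n → Set
MapsOnto b n S T =
  (∀ (s : Fin n) → s ∈ S → ((b ℤ.* + toℕ s) %ℕ n) ∈ℕ T) ×
  (∀ (t : Fin n) → t ∈ T → Σ (Fin n) λ s → s ∈ S × toℕ t ≡ (b ℤ.* + toℕ s) %ℕ n)

GivesSplitting : (b : ℤ) (q2 n : ℕ) .{{_ : NonZero n}} → Set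
GivesSplitting b q2 n = Σ (Subset n) λ S₁ → Σ (Subset n) λ S₂ →
  UnionOfCosets q2 n S₁ × UnionOfCosets q2 n S₂ ×
  (∀ (x : Fin n) → (x ∈ S₁ ⊎ x ∈ S₂) → toℕ x ≢ 0) ×
  (∀ (x : Fin n) → toℕ x ≢ 0 → x ∈ S₁ ⊎ x ∈ S₂) ×
  (∀ (x : Fin n) → x ∈ S₁ → x ∈ S₂ → ⊥) ×
  MapsOnto b n S₁ S₂ × MapsOnto b n S₂ S₁

module Submission where

-- Let μ x = -q x on residues mod n. As μ commutes with multiplication by q² and
-- μ² = q², μ maps q²-cyclotomic cosets to cosets and is an involution on them, so
-- a splitting exists exactly when μ fixes no nonzero coset, i.e. when no nonzero x
-- has -q x ≡ x q²ⁱ (mod n). Such an x exists iff some q²ⁱ⁻¹ + 1 shares a factor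
-- d > 1 with n (take x = n / d). If μ fixes no coset, put x into S₁ or S₂ according
-- to whether the least element of its coset is below or above that of μ x.

open import Defs
open import Data.Bool.Properties using (T-≡)
open import Data.Empty using (⊥; ⊥-elim)
open import Data.Fin using (Fin; toℕ; fromℕ<)
open import Data.Fin.Properties using (pigeonhole; toℕ-fromℕ<; toℕ-injective; toℕ<n)
open import Data.Fin.Subset using (Subset; _∈_)
open import Data.Integer using (ℤ; +_; -_; _%ℕ_)
import Data.Integer as ℤ
import Data.Integer.Properties as ℤ
open import Data.Integer.DivMod using (n%ℕd<d)
open import Data.Nat
open import Data.Nat.Coprimality using (Coprime; coprime-Bézout; gcd≡1⇒coprime; coprime-divisor)
open import Data.Nat.Divisibility using (_∣_; divides; ∣⇒≤; m%n≡0⇒n∣m)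
open import Data.Nat.DivMod
open import Data.Nat.GCD using (gcd; gcd[m,n]∣m; gcd[m,n]∣n; module Bézout)
open import Data.Nat.Properties
open import Data.Nat.Tactic.RingSolver using (solve-∀)
open import Data.Product using (Σ; ∃; _×_; _,_)
open import Data.Sum using (_⊎_; inj₁; inj₂)
open import Data.Vec using (tabulate)
open import Data.Vec.Properties using (lookup∘tabulate; []=⇒lookup; lookup⇒[]=)
open import Function using (flip)
open import Function.Bundles using (_⇔_; mk⇔; Equivalence)
open import Relation.Binary.Bundles using (Setoid)
import Relation.Binary.Construct.On as On
open import Relation.Binary.Definitions using (Decidable; tri<; tri≈; tri>)
open import Relation.Binary.PropositionalEquality
import Relation.Binary.Reasoning.Setoid as SetoidReasoning
open import Relation.Nullary using (¬_)
open import Relation.Nullary.Decidable using (⌊_⌋; toWitness; fromWitness; decidable-stable)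

module Congruence (n : ℕ) .{{_ : NonZero n}} where

  infix 4 _≈_
  _≈_ : ℕ → ℕ → Set
  a ≈ b = a % n ≡ b % n

  ≈-setoid : Setoid _ _
  ≈-setoid = On.setoid (setoid ℕ) (_% n)

  open Setoid ≈-setoid public
    using () renaming (sym to ≈-sym; trans to ≈-trans; reflexive to ≡⇒≈)
  module ≈-Reasoning = SetoidReasoning ≈-setoid

  %-≈ : ∀ a → a % n ≈ a
  %-≈ a = m%n%n≡m%n a n

  *-cong : ∀ {a b c d} → a ≈ b → c ≈ d → a * c ≈ b * d
  *-cong {a} {b} {c} {d} a≈b c≈d = begin
    (a * c) % n             ≡⟨ %-distribˡ-* a c n ⟩
    ((a % n) * (c % n)) % n ≡⟨ cong₂ (λ x y → (x * y) % n) a≈b c≈d ⟩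
    ((b % n) * (d % n)) % n ≡⟨ %-distribˡ-* b d n ⟨
    (b * d) % n             ∎
    where open ≡-Reasoning

  *-congˡ : ∀ a {b c} → b ≈ c → a * b ≈ a * c
  *-congˡ a = *-cong {a} {a} refl

  *-congʳ : ∀ c {a b} → a ≈ b → a * c ≈ b * c
  *-congʳ c a≈b = *-cong {c = c} {d = c} a≈b refl

  +-congˡ : ∀ a {b c} → b ≈ c → a + b ≈ a + c
  +-congˡ a {b} {c} b≈c = begin
    (a + b) % n             ≡⟨ %-distribˡ-+ a b n ⟩
    ((a % n) + (b % n)) % n ≡⟨ cong (λ y → (a % n + y) % n) b≈c ⟩
    ((a % n) + (c % n)) % n ≡⟨ %-distribˡ-+ a c n ⟨
    (a + c) % n             ∎
    where open ≡-Reasoning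

  +-congʳ : ∀ c {a b} → a ≈ b → a + c ≈ b + c
  +-congʳ c {a} {b} a≈b = ≈-trans (≡⇒≈ (+-comm a c)) (≈-trans (+-congˡ c a≈b) (≡⇒≈ (+-comm c b)))

  ^-cong : ∀ t {a b} → a ≈ b → a ^ t ≈ b ^ t
  ^-cong zero    a≈b = refl
  ^-cong (suc t) a≈b = *-cong a≈b (^-cong t a≈b)

  0%n≡0 : 0 % n ≡ 0
  0%n≡0 = m<n⇒m%n≡m (>-nonZero⁻¹ n)

  *n≈0 : ∀ x → x * n ≈ 0
  *n≈0 x = trans (m*n%n≡0 x n) (sym 0%n≡0)

  ≈0⇒∣ : ∀ {a} → a ≈ 0 → n ∣ a
  ≈0⇒∣ {a} a≈0 = m%n≡0⇒n∣m a n (trans a≈0 0%n≡0)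

  ∣⇒≈0 : ∀ {a} → n ∣ a → a ≈ 0
  ∣⇒≈0 (divides x refl) = *n≈0 x

  [n∸1]*x+x≈0 : ∀ x → (n ∸ 1) * x + x ≈ 0
  [n∸1]*x+x≈0 x = begin
    (n ∸ 1) * x + x   ≡⟨ distrib (n ∸ 1) x ⟩
    (n ∸ 1 + 1) * x   ≡⟨ cong (_* x) (m∸n+n≡m (>-nonZero⁻¹ n)) ⟩
    n * x             ≡⟨ *-comm n x ⟩
    x * n             ≈⟨ *n≈0 x ⟩
    0                 ∎
    where
    open ≈-Reasoning
    distrib : ∀ m x → m * x + x ≡ (m + 1) * x
    distrib = solve-∀

  +-cancelʳ-≈ : ∀ {a b} c → a + c ≈ b + c → a ≈ b
  +-cancelʳ-≈ {a} {b} c a+c≈b+c = begin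
    a                     ≈⟨ cancels a ⟨
    a + c + (n ∸ 1) * c   ≈⟨ +-congʳ ((n ∸ 1) * c) a+c≈b+c ⟩
    b + c + (n ∸ 1) * c   ≈⟨ cancels b ⟩
    b                     ∎
    where
    open ≈-Reasoning
    reassoc : ∀ y c m → y + c + m ≡ y + (m + c)
    reassoc = solve-∀
    cancels : ∀ y → y + c + (n ∸ 1) * c ≈ y
    cancels y = begin
      y + c + (n ∸ 1) * c     ≡⟨ reassoc y c ((n ∸ 1) * c) ⟩
      y + ((n ∸ 1) * c + c)   ≈⟨ +-congˡ y ([n∸1]*x+x≈0 c) ⟩
      y + 0                   ≡⟨ +-identityʳ y ⟩
      y                       ∎

  +≈0⇒≈[n∸1]* : ∀ {a} c → a + c ≈ 0 → a ≈ (n ∸ 1) * c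
  +≈0⇒≈[n∸1]* c a+c≈0 = +-cancelʳ-≈ c (≈-trans a+c≈0 (≈-sym ([n∸1]*x+x≈0 c)))

  [n∸1]²≈1 : (n ∸ 1) * (n ∸ 1) ≈ 1
  [n∸1]²≈1 = ≈-sym (+≈0⇒≈[n∸1]* (n ∸ 1) 1+[n∸1]≈0)
    where
    1+[n∸1]≈0 : 1 + (n ∸ 1) ≈ 0
    1+[n∸1]≈0 = ≈-trans (≡⇒≈ (trans (+-comm 1 (n ∸ 1)) (m∸n+n≡m (>-nonZero⁻¹ n))))
                        (≈-trans (≡⇒≈ (sym (*-identityˡ n))) (*n≈0 1))

  -[t]%ℕn+t≈0 : ∀ t → (- (+ t)) %ℕ n + t ≈ 0
  -[t]%ℕn+t≈0 zero = cong (_% n) (trans (+-identityʳ (0 % n)) 0%n≡0)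
  -[t]%ℕn+t≈0 (suc u) with suc u % n in t%n≡
  ... | zero  = trans t%n≡ (sym 0%n≡0)
  ... | suc r = begin
    n ∸ suc r + suc u   ≈⟨ +-congˡ (n ∸ suc r) (trans t%n≡ (sym (m<n⇒m%n≡m r<n))) ⟩
    n ∸ suc r + suc r   ≡⟨ m∸n+n≡m (<⇒≤ r<n) ⟩
    n                   ≡⟨ *-identityˡ n ⟨
    1 * n               ≈⟨ *n≈0 1 ⟩
    0                   ∎
    where
    open ≈-Reasoning
    r<n : suc r < n
    r<n = subst (_< n) t%n≡ (m%n<n (suc u) n)

  -[t]%ℕn≡[[n∸1]*t]%n : ∀ t → (- (+ t)) %ℕ n ≡ ((n ∸ 1) * t) % n
  -[t]%ℕn≡[[n∸1]*t]%n t = trans (sym (m<n⇒m%n≡m (n%ℕd<d (- (+ t)) n)))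
                                (+≈0⇒≈[n∸1]* t (-[t]%ℕn+t≈0 t))

  coprime⇒invertible : ∀ {q} → Coprime n q → ∃ λ u → u * q ≈ 1
  coprime⇒invertible {q} c with coprime-Bézout c
  ... | Bézout.+- x y 1+yq≡xn = (n ∸ 1) * y , (begin
    (n ∸ 1) * y * q     ≡⟨ *-assoc (n ∸ 1) y q ⟩
    (n ∸ 1) * (y * q)   ≈⟨ +≈0⇒≈[n∸1]* (y * q) (≈-trans (≡⇒≈ 1+yq≡xn) (*n≈0 x)) ⟨
    1                   ∎)
    where open ≈-Reasoning
  ... | Bézout.-+ x y 1+xn≡yq = y , (begin
    y * q       ≡⟨ 1+xn≡yq ⟨
    1 + x * n   ≈⟨ +-congˡ 1 (*n≈0 x) ⟩
    1 + 0       ≡⟨ +-identityʳ 1 ⟩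
    1           ∎)
    where open ≈-Reasoning

  invertible-^ : ∀ {v p} → v * p ≈ 1 → ∀ t → v ^ t * p ^ t ≈ 1
  invertible-^ vp≈1 zero    = refl
  invertible-^ {v} {p} vp≈1 (suc t) = begin
    v * v ^ t * (p * p ^ t)     ≡⟨ interchange v (v ^ t) p (p ^ t) ⟩
    v * p * (v ^ t * p ^ t)     ≈⟨ *-cong vp≈1 (invertible-^ vp≈1 t) ⟩
    1 * 1                       ∎
    where
    open ≈-Reasoning
    interchange : ∀ a b c d → a * b * (c * d) ≡ a * c * (b * d)
    interchange = solve-∀

  invertible-cancelˡ : ∀ {v c a b} → v * c ≈ 1 → c * a ≈ c * b → a ≈ b
  invertible-cancelˡ {v} {c} {a} {b} vc≈1 ca≈cb = begin
    a             ≡⟨ *-identityˡ a ⟨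
    1 * a         ≈⟨ *-congʳ a vc≈1 ⟨
    v * c * a     ≡⟨ *-assoc v c a ⟩
    v * (c * a)   ≈⟨ *-congˡ v ca≈cb ⟩
    v * (c * b)   ≡⟨ *-assoc v c b ⟨
    v * c * b     ≈⟨ *-congʳ b vc≈1 ⟩
    1 * b         ≡⟨ *-identityˡ b ⟩
    b             ∎
    where open ≈-Reasoning

  invertible⇒periodic : ∀ {v p} → v * p ≈ 1 → ∃ λ k → p ^ suc k ≈ 1
  invertible⇒periodic {v} {p} vp≈1
    with pigeonhole (n<1+n n) (λ j → fromℕ< (m%n<n (p ^ toℕ j) n))
  ... | i , j , i<j , same-residue = k , invertible-cancelˡ {v ^ toℕ i} {p ^ toℕ i} (invertible-^ {v} {p} vp≈1 (toℕ i)) (begin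
    p ^ toℕ i * p ^ suc k   ≡⟨ ^-distribˡ-+-* p (toℕ i) (suc k) ⟨
    p ^ (toℕ i + suc k)     ≡⟨ cong (p ^_) (trans (+-suc (toℕ i) k) (m+[n∸m]≡n i<j)) ⟩
    p ^ toℕ j               ≈⟨ pⁱ≈pʲ ⟨
    p ^ toℕ i               ≡⟨ *-identityʳ (p ^ toℕ i) ⟨
    p ^ toℕ i * 1           ∎)
    where
    open ≈-Reasoning
    k : ℕ
    k = toℕ j ∸ suc (toℕ i)
    pⁱ≈pʲ : p ^ toℕ i ≈ p ^ toℕ j
    pⁱ≈pʲ = trans (sym (toℕ-fromℕ< _)) (trans (cong toℕ same-residue) (toℕ-fromℕ< _))

module CosetMinimum (n : ℕ) .{{_ : NonZero n}} (p k : ℕ)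
                    (p^[1+k]≈1 : Congruence._≈_ n (p ^ suc k) 1) where

  open Congruence n

  orbit : ℕ → ℕ → ℕ
  orbit x j = (x * p ^ j) % n

  p^[t*[1+k]]≈1 : ∀ t → p ^ (t * suc k) ≈ 1
  p^[t*[1+k]]≈1 t = begin
    p ^ (t * suc k)   ≡⟨ cong (p ^_) (*-comm t (suc k)) ⟩
    p ^ (suc k * t)   ≡⟨ ^-*-assoc p (suc k) t ⟨
    (p ^ suc k) ^ t   ≈⟨ ^-cong t p^[1+k]≈1 ⟩
    1 ^ t             ≡⟨ ^-zeroˡ t ⟩
    1                 ∎
    where open ≈-Reasoning

  orbit-periodic : ∀ x r t → orbit x (r + t * suc k) ≡ orbit x r
  orbit-periodic x r t = begin
    x * p ^ (r + t * suc k)         ≡⟨ cong (x *_) (^-distribˡ-+-* p r (t * suc k)) ⟩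
    x * (p ^ r * p ^ (t * suc k))   ≈⟨ *-congˡ x (*-congˡ (p ^ r) (p^[t*[1+k]]≈1 t)) ⟩
    x * (p ^ r * 1)                 ≡⟨ cong (x *_) (*-identityʳ (p ^ r)) ⟩
    x * p ^ r                       ∎
    where open ≈-Reasoning

  orbit-%[1+k] : ∀ x j → orbit x j ≡ orbit x (j % suc k)
  orbit-%[1+k] x j = trans (cong (orbit x) (m≡m%n+[m/n]*n j (suc k)))
                           (orbit-periodic x (j % suc k) (j / suc k))

  orbit-cong : ∀ {x y} j → x ≈ y → orbit x j ≡ orbit y j
  orbit-cong j = *-congʳ (p ^ j)

  orbit-orbit : ∀ x a j → orbit (orbit x a) j ≡ orbit x (a + j)
  orbit-orbit x a j = begin
    (x * p ^ a) % n * p ^ j   ≈⟨ *-congʳ (p ^ j) (%-≈ (x * p ^ a)) ⟩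
    x * p ^ a * p ^ j         ≡⟨ *-assoc x (p ^ a) (p ^ j) ⟩
    x * (p ^ a * p ^ j)       ≡⟨ cong (x *_) (^-distribˡ-+-* p a j) ⟨
    x * p ^ (a + j)           ∎
    where open ≈-Reasoning

  minOrbit : ℕ → ℕ → ℕ
  minOrbit x zero    = n
  minOrbit x (suc J) = orbit x J ⊓ minOrbit x J

  minOrbit≤orbit : ∀ x {j} J → j < J → minOrbit x J ≤ orbit x j
  minOrbit≤orbit x {j} (suc J) (s≤s j≤J) with m≤n⇒m<n∨m≡n j≤J
  ... | inj₁ j<J  = ≤-trans (m⊓n≤n (orbit x J) (minOrbit x J)) (minOrbit≤orbit x J j<J)
  ... | inj₂ refl = m⊓n≤m (orbit x J) (minOrbit x J)

  minOrbit-attained : ∀ x J → ∃ λ j → minOrbit x (suc J) ≡ orbit x j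
  minOrbit-attained x zero    = 0 , m≤n⇒m⊓n≡m (<⇒≤ (m%n<n (x * p ^ 0) n))
  minOrbit-attained x (suc J) with ⊓-sel (orbit x (suc J)) (minOrbit x (suc J))
  ... | inj₁ here  = suc J , here
  ... | inj₂ there with minOrbit-attained x J
  ...   | j , attained = j , trans there attained

  minOrbit-cong : ∀ {x y} J → x ≈ y → minOrbit x J ≡ minOrbit y J
  minOrbit-cong zero    x≈y = refl
  minOrbit-cong (suc J) x≈y = cong₂ _⊓_ (orbit-cong J x≈y) (minOrbit-cong J x≈y)

  cosetMin : ℕ → ℕ
  cosetMin x = minOrbit x (suc k)

  cosetMin≤orbit : ∀ x j → cosetMin x ≤ orbit x j
  cosetMin≤orbit x j = subst (cosetMin x ≤_) (sym (orbit-%[1+k] x j))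
                             (minOrbit≤orbit x (suc k) (m%n<n j (suc k)))

  cosetMin-attained : ∀ x → ∃ λ j → cosetMin x ≡ orbit x j
  cosetMin-attained x = minOrbit-attained x k

  cosetMin-cong : ∀ {x y} → x ≈ y → cosetMin x ≡ cosetMin y
  cosetMin-cong = minOrbit-cong (suc k)

  cosetMin-orbit : ∀ x a → cosetMin (orbit x a) ≡ cosetMin x
  cosetMin-orbit x a with cosetMin-attained (orbit x a) | cosetMin-attained x
  ... | j₀ , min₀ | j₁ , min₁ = ≤-antisym ≤min₁ ≥min₀
    where
    open ≤-Reasoning
    shift : ∀ a j k → a + (j + a * k) ≡ j + a * suc k
    shift = solve-∀
    ≤min₁ : cosetMin (orbit x a) ≤ cosetMin x
    ≤min₁ = begin
      cosetMin (orbit x a)              ≤⟨ cosetMin≤orbit (orbit x a) (j₁ + a * k) ⟩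
      orbit (orbit x a) (j₁ + a * k)    ≡⟨ orbit-orbit x a (j₁ + a * k) ⟩
      orbit x (a + (j₁ + a * k))        ≡⟨ cong (orbit x) (shift a j₁ k) ⟩
      orbit x (j₁ + a * suc k)          ≡⟨ orbit-periodic x j₁ a ⟩
      orbit x j₁                        ≡⟨ min₁ ⟨
      cosetMin x                        ∎
    ≥min₀ : cosetMin x ≤ cosetMin (orbit x a)
    ≥min₀ = begin
      cosetMin x                  ≤⟨ cosetMin≤orbit x (a + j₀) ⟩
      orbit x (a + j₀)            ≡⟨ orbit-orbit x a j₀ ⟨
      orbit (orbit x a) j₀        ≡⟨ min₀ ⟨
      cosetMin (orbit x a)        ∎

  cosetMin-*p^ : ∀ x a → cosetMin (x * p ^ a) ≡ cosetMin x
  cosetMin-*p^ x a = trans (cosetMin-cong (≈-sym (%-≈ (x * p ^ a)))) (cosetMin-orbit x a)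

  cosetMin≡⇒sameCoset : ∀ {x y} → cosetMin x ≡ cosetMin y → ∃ λ j → y ≈ x * p ^ j
  cosetMin≡⇒sameCoset {x} {y} same with cosetMin-attained x | cosetMin-attained y
  ... | j₁ , min₁ | j₂ , min₂ = j₁ + j₂ * k , (begin
    y                               ≡⟨ *-identityʳ y ⟨
    y * 1                           ≈⟨ orbit-periodic y 0 j₂ ⟨
    y * p ^ (j₂ * suc k)            ≡⟨ cong (λ e → y * p ^ e) (*-suc j₂ k) ⟩
    y * p ^ (j₂ + j₂ * k)           ≡⟨ cong (y *_) (^-distribˡ-+-* p j₂ (j₂ * k)) ⟩
    y * (p ^ j₂ * p ^ (j₂ * k))     ≡⟨ *-assoc y (p ^ j₂) (p ^ (j₂ * k)) ⟨
    y * p ^ j₂ * p ^ (j₂ * k)       ≈⟨ *-congʳ (p ^ (j₂ * k)) (trans (sym min₂) (trans (sym same) min₁)) ⟩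
    x * p ^ j₁ * p ^ (j₂ * k)       ≡⟨ *-assoc x (p ^ j₁) (p ^ (j₂ * k)) ⟩
    x * (p ^ j₁ * p ^ (j₂ * k))     ≡⟨ cong (x *_) (^-distribˡ-+-* p j₁ (j₂ * k)) ⟨
    x * p ^ (j₁ + j₂ * k)           ∎)
    where open ≈-Reasoning

q^[2[1+j]∸1]≡q*[q²]^j : ∀ q j → q ^ (2 * suc j ∸ 1) ≡ q * (q ^ 2) ^ j
q^[2[1+j]∸1]≡q*[q²]^j q j = trans (cong (q ^_) (+-suc j (j + 0))) (cong (q *_) (sym (^-*-assoc q 2 j)))

gcd≢1⇒zero-divisor : ∀ n m .{{_ : NonZero n}} → gcd n m ≢ 1 →
                     ∃ λ x → x ≢ 0 × x < n × n ∣ x * m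
gcd≢1⇒zero-divisor n m gcd≢1 with gcd[m,n]∣m n m | gcd[m,n]∣n n m
... | divides x n≡xd | divides e m≡ed = x , x≢0 , x<n , divides e x*m≡e*n
  where
  d : ℕ
  d = gcd n m
  x≢0 : x ≢ 0
  x≢0 refl = ≢-nonZero⁻¹ n n≡xd
  1<d : 1 < d
  1<d with d
  ... | 0           = ⊥-elim (≢-nonZero⁻¹ n (trans n≡xd (*-zeroʳ x)))
  ... | 1           = ⊥-elim (gcd≢1 refl)
  ... | suc (suc _) = s≤s (s≤s z≤n)
  x<n : x < n
  x<n = subst (x <_) (sym n≡xd) (m<m*n x d {{≢-nonZero x≢0}} 1<d)
  swap : ∀ x e d → x * (e * d) ≡ e * (x * d)
  swap = solve-∀
  x*m≡e*n : x * m ≡ e * n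
  x*m≡e*n = trans (cong (x *_) m≡ed) (trans (swap x e d) (cong (e *_) (sym n≡xd)))

module _ {b : ℤ} {q2 n : ℕ} .{{_ : NonZero n}} where

  maps-across⇒leaves-coset : ∀ {A B : Subset n} → UnionOfCosets q2 n A → MapsOnto b n A B →
                             (∀ x → x ∈ A → x ∈ B → ⊥) →
                             ∀ (s : Fin n) → s ∈ A → ∀ j → (b ℤ.* + toℕ s) %ℕ n ≢ (toℕ s * q2 ^ j) % n
  maps-across⇒leaves-coset {A} {B} A-cosets (A→B , _) disjoint s s∈A j bs≡
    with A→B s s∈A | A-cosets s s∈A _ (j , bs≡)
  ... | t , t≡bs , t∈B | t′ , t′≡bs , t′∈A =
    disjoint t′ t′∈A (subst (_∈ B) (toℕ-injective (trans t≡bs (sym t′≡bs))) t∈B)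

  splitting⇒leaves-coset : GivesSplitting b q2 n → ∀ (s : Fin n) → toℕ s ≢ 0 →
                           ∀ j → (b ℤ.* + toℕ s) %ℕ n ≢ (toℕ s * q2 ^ j) % n
  splitting⇒leaves-coset (S₁ , S₂ , S₁-cosets , S₂-cosets , _ , covers , disjoint , S₁→S₂ , S₂→S₁) s s≢0
    with covers s s≢0
  ... | inj₁ s∈S₁ = maps-across⇒leaves-coset S₁-cosets S₁→S₂ disjoint s s∈S₁
  ... | inj₂ s∈S₂ = maps-across⇒leaves-coset S₂-cosets S₂→S₁ (λ x x∈S₂ x∈S₁ → disjoint x x∈S₁ x∈S₂) s s∈S₂

module Multiplier (q n : ℕ) .{{_ : NonZero n}} where

  open Congruence n

  μ : ℕ → ℕ
  μ x = (n ∸ 1) * q * x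

  μ-residue : ∀ s → (- (+ q) ℤ.* + s) %ℕ n ≡ μ s % n
  μ-residue s = begin
    (- (+ q) ℤ.* + s) %ℕ n    ≡⟨ cong (_%ℕ n) (ℤ.neg-distribˡ-* (+ q) (+ s)) ⟨
    (- (+ q ℤ.* + s)) %ℕ n    ≡⟨ cong (λ z → (- z) %ℕ n) (ℤ.pos-* q s) ⟨
    (- (+ (q * s))) %ℕ n      ≡⟨ -[t]%ℕn≡[[n∸1]*t]%n (q * s) ⟩
    ((n ∸ 1) * (q * s)) % n   ≡⟨ cong (_% n) (*-assoc (n ∸ 1) q s) ⟨
    μ s % n                   ∎
    where open ≡-Reasoning

  μ-cong : ∀ {x y} → x ≈ y → μ x ≈ μ y
  μ-cong = *-congˡ ((n ∸ 1) * q)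

  μ-*ʳ : ∀ x y → μ (x * y) ≡ μ x * y
  μ-*ʳ x y = sym (*-assoc ((n ∸ 1) * q) x y)

  μ-μ : ∀ x → μ (μ x) ≈ x * q ^ 2
  μ-μ x = begin
    μ (μ x)                          ≡⟨ regroup (n ∸ 1) q x ⟩
    (n ∸ 1) * (n ∸ 1) * (x * q ^ 2)  ≈⟨ *-congʳ (x * q ^ 2) [n∸1]²≈1 ⟩
    1 * (x * q ^ 2)                  ≡⟨ *-identityˡ (x * q ^ 2) ⟩
    x * q ^ 2                        ∎
    where
    open ≈-Reasoning
    regroup : ∀ m q x → m * q * (m * q * x) ≡ m * m * (x * (q * (q * 1)))
    regroup = solve-∀

  x*[q*[q²]^j+1]≈0⇒μx≈x*[q²]^[1+j] : ∀ x j → x * (q * (q ^ 2) ^ j + 1) ≈ 0 → μ x ≈ x * (q ^ 2) ^ suc j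
  x*[q*[q²]^j+1]≈0⇒μx≈x*[q²]^[1+j] x j annihilates = begin
    (n ∸ 1) * q * x                 ≡⟨ rotate (n ∸ 1) q x ⟩
    (n ∸ 1) * x * q                 ≈⟨ *-congʳ q (≈-sym xQ≈[n∸1]*x) ⟩
    x * (q * (q ^ 2) ^ j) * q       ≡⟨ regroup x q ((q ^ 2) ^ j) ⟩
    x * (q ^ 2) ^ suc j             ∎
    where
    open ≈-Reasoning
    rotate : ∀ m q x → m * q * x ≡ m * x * q
    rotate = solve-∀
    regroup : ∀ x q r → x * (q * r) * q ≡ x * (q * (q * 1) * r)
    regroup = solve-∀
    distrib : ∀ x Q → x * (Q + 1) ≡ x * Q + x
    distrib = solve-∀
    xQ≈[n∸1]*x : x * (q * (q ^ 2) ^ j) ≈ (n ∸ 1) * x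
    xQ≈[n∸1]*x = +≈0⇒≈[n∸1]* x (≈-trans (≡⇒≈ (sym (distrib x (q * (q ^ 2) ^ j)))) annihilates)

  x≈μx*[q²]^j⇒x*[q*[q²]^j+1]≈0 : ∀ x j → x ≈ μ x * (q ^ 2) ^ j → x * (q * (q ^ 2) ^ j + 1) ≈ 0
  x≈μx*[q²]^j⇒x*[q*[q²]^j+1]≈0 x j x≈μx*r = begin
    x * (Q + 1)                ≡⟨ distrib x Q ⟩
    x * Q + x                  ≈⟨ +-congˡ (x * Q) x≈μx*r ⟩
    x * Q + μ x * r            ≡⟨ cong (_+_ (x * Q)) (regroup (n ∸ 1) q x r) ⟩
    x * Q + (n ∸ 1) * (x * Q)  ≡⟨ +-comm (x * Q) ((n ∸ 1) * (x * Q)) ⟩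
    (n ∸ 1) * (x * Q) + x * Q  ≈⟨ [n∸1]*x+x≈0 (x * Q) ⟩
    0                          ∎
    where
    open ≈-Reasoning
    r Q : ℕ
    r = (q ^ 2) ^ j
    Q = q * r
    distrib : ∀ x Q → x * (Q + 1) ≡ x * Q + x
    distrib = solve-∀
    regroup : ∀ m q x r → m * q * x * r ≡ m * (x * (q * r))
    regroup = solve-∀

  splitting⇒μ-changes-coset : GivesSplitting (- (+ q)) (q ^ 2) n →
                              ∀ x → x < n → x ≢ 0 → ∀ i → ¬ (μ x ≈ x * (q ^ 2) ^ i)
  splitting⇒μ-changes-coset split x x<n x≢0 i μx≈ =
    splitting⇒leaves-coset {b = - (+ q)} split s (λ s≡0 → x≢0 (trans (sym s≡x) s≡0)) i (begin
      (- (+ q) ℤ.* + toℕ s) %ℕ n      ≡⟨ μ-residue (toℕ s) ⟩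
      μ (toℕ s) % n                   ≡⟨ cong (λ y → μ y % n) s≡x ⟩
      μ x % n                         ≡⟨ μx≈ ⟩
      (x * (q ^ 2) ^ i) % n           ≡⟨ cong (λ y → (y * (q ^ 2) ^ i) % n) s≡x ⟨
      (toℕ s * (q ^ 2) ^ i) % n       ∎)
    where
    open ≡-Reasoning
    s : Fin n
    s = fromℕ< x<n
    s≡x : toℕ s ≡ x
    s≡x = toℕ-fromℕ< x<n

  splitting⇒gcd≡1 : GivesSplitting (- (+ q)) (q ^ 2) n →
                    ∀ i → 1 ≤ i → gcd n (q ^ (2 * i ∸ 1) + 1) ≡ 1
  splitting⇒gcd≡1 split (suc j) _ = decidable-stable (gcd n m ≟ 1) λ gcd≢1 →
    let x , x≢0 , x<n , n∣x*m = gcd≢1⇒zero-divisor n m gcd≢1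
    in splitting⇒μ-changes-coset split x x<n x≢0 (suc j)
         (x*[q*[q²]^j+1]≈0⇒μx≈x*[q²]^[1+j] x j
           (subst (λ Q → x * (Q + 1) ≈ 0) (q^[2[1+j]∸1]≡q*[q²]^j q j) (∣⇒≈0 n∣x*m)))
    where
    m : ℕ
    m = q ^ (2 * suc j ∸ 1) + 1

  module _ (k : ℕ) (q²-period : (q ^ 2) ^ suc k ≈ 1) where

    open CosetMinimum n (q ^ 2) k q²-period

    gcd≡1⇒μ-changes-coset : (∀ i → 1 ≤ i → gcd n (q ^ (2 * i ∸ 1) + 1) ≡ 1) →
                            ∀ x → x < n → x ≢ 0 → cosetMin x ≢ cosetMin (μ x)
    gcd≡1⇒μ-changes-coset gcd≡1 x x<n x≢0 same with cosetMin≡⇒sameCoset (sym same)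
    ... | j , x≈μx*r = <⇒≱ x<n (∣⇒≤ {{≢-nonZero x≢0}} (coprime-divisor n⊥Q+1 n∣[Q+1]*x))
      where
      Q : ℕ
      Q = q * (q ^ 2) ^ j
      n⊥Q+1 : Coprime n (Q + 1)
      n⊥Q+1 = gcd≡1⇒coprime (subst (λ Q → gcd n (Q + 1) ≡ 1) (q^[2[1+j]∸1]≡q*[q²]^j q j) (gcd≡1 (suc j) (s≤s z≤n)))
      n∣[Q+1]*x : n ∣ (Q + 1) * x
      n∣[Q+1]*x = ≈0⇒∣ (≈-trans (≡⇒≈ (*-comm (Q + 1) x)) (x≈μx*[q²]^j⇒x*[q*[q²]^j+1]≈0 x j x≈μx*r))

    μ⁻¹ : ℕ → ℕ
    μ⁻¹ w = orbit (μ w) k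

    μ-μ⁻¹ : ∀ w → μ (μ⁻¹ w) ≈ w
    μ-μ⁻¹ w = begin
      μ ((μ w * (q ^ 2) ^ k) % n)   ≈⟨ μ-cong (%-≈ (μ w * (q ^ 2) ^ k)) ⟩
      μ (μ w * (q ^ 2) ^ k)         ≡⟨ μ-*ʳ (μ w) ((q ^ 2) ^ k) ⟩
      μ (μ w) * (q ^ 2) ^ k         ≈⟨ *-congʳ ((q ^ 2) ^ k) (μ-μ w) ⟩
      w * q ^ 2 * (q ^ 2) ^ k       ≡⟨ *-assoc w (q ^ 2) ((q ^ 2) ^ k) ⟩
      w * (q ^ 2) ^ suc k           ≈⟨ *-congˡ w q²-period ⟩
      w * 1                         ≡⟨ *-identityʳ w ⟩
      w                             ∎
      where open ≈-Reasoning

    cosetMin-μ-orbit : ∀ x j → cosetMin (μ (orbit x j)) ≡ cosetMin (μ x)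
    cosetMin-μ-orbit x j = begin
      cosetMin (μ (orbit x j))         ≡⟨ cosetMin-cong (μ-cong (%-≈ (x * (q ^ 2) ^ j))) ⟩
      cosetMin (μ (x * (q ^ 2) ^ j))   ≡⟨ cong cosetMin (μ-*ʳ x ((q ^ 2) ^ j)) ⟩
      cosetMin (μ x * (q ^ 2) ^ j)     ≡⟨ cosetMin-*p^ (μ x) j ⟩
      cosetMin (μ x)                   ∎
      where open ≡-Reasoning

    cosetMin-μ-μ : ∀ x → cosetMin (μ (μ x % n)) ≡ cosetMin x
    cosetMin-μ-μ x = begin
      cosetMin (μ (μ x % n))       ≡⟨ cosetMin-cong (μ-cong (%-≈ (μ x))) ⟩
      cosetMin (μ (μ x))           ≡⟨ cosetMin-cong (μ-μ x) ⟩
      cosetMin (x * q ^ 2)         ≡⟨ cong (λ r → cosetMin (x * r)) (*-identityʳ (q ^ 2)) ⟨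
      cosetMin (x * (q ^ 2) ^ 1)   ≡⟨ cosetMin-*p^ x 1 ⟩
      cosetMin x                   ∎
      where open ≡-Reasoning

    Compares : (ℕ → ℕ → Set) → ℕ → Set
    Compares R x = R (cosetMin x) (cosetMin (μ x))

    side : (R : ℕ → ℕ → Set) → Decidable R → Subset n
    side R R? = tabulate λ i → ⌊ R? (cosetMin (toℕ i)) (cosetMin (μ (toℕ i))) ⌋

    module SideMembership (R : ℕ → ℕ → Set) (R? : Decidable R) where

      ∈side⇒ : ∀ i → i ∈ side R R? → Compares R (toℕ i)
      ∈side⇒ i i∈ = toWitness {a? = R? _ _} (Equivalence.from T-≡ (trans (sym (lookup∘tabulate _ i)) ([]=⇒lookup i∈)))

      ⇒∈side : ∀ i → Compares R (toℕ i) → i ∈ side R R?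
      ⇒∈side i r = lookup⇒[]= i _ (trans (lookup∘tabulate _ i) (Equivalence.to T-≡ (fromWitness {a? = R? _ _} r)))

      ⇒∈ℕside : ∀ y → y < n → Compares R y → y ∈ℕ side R R?
      ⇒∈ℕside y y<n r = fromℕ< y<n , toℕ-fromℕ< y<n , ⇒∈side _ (subst (Compares R) (sym (toℕ-fromℕ< y<n)) r)

    open SideMembership

    side-cosets : ∀ R R? → UnionOfCosets (q ^ 2) n (side R R?)
    side-cosets R R? s s∈ t (j , t≡orbit) = ⇒∈ℕside R R? t (subst (_< n) (sym t≡orbit) (m%n<n _ n))
      (subst (Compares R) (sym t≡orbit)
        (subst₂ R (sym (cosetMin-orbit (toℕ s) j)) (sym (cosetMin-μ-orbit (toℕ s) j)) (∈side⇒ R R? s s∈)))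

    side-maps : ∀ R R? → MapsOnto (- (+ q)) n (side R R?) (side (flip R) (flip R?))
    side-maps R R? = forward , backward
      where
      forward : ∀ s → s ∈ side R R? → (((- (+ q)) ℤ.* + toℕ s) %ℕ n) ∈ℕ side (flip R) (flip R?)
      forward s s∈ = subst (_∈ℕ side (flip R) (flip R?)) (sym (μ-residue (toℕ s)))
        (⇒∈ℕside (flip R) (flip R?) _ (m%n<n _ n)
          (subst₂ R (sym (cosetMin-μ-μ (toℕ s))) (sym (cosetMin-cong (%-≈ (μ (toℕ s))))) (∈side⇒ R R? s s∈)))
      backward : ∀ t → t ∈ side (flip R) (flip R?) →
                 Σ (Fin n) λ s → s ∈ side R R? × toℕ t ≡ ((- (+ q)) ℤ.* + toℕ s) %ℕ n
      backward t t∈ = s , ⇒∈side R R? s (subst (Compares R) (sym s≡) r) , sym t≡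
        where
        w : ℕ
        w = toℕ t
        s : Fin n
        s = fromℕ< (m%n<n (μ w * (q ^ 2) ^ k) n)
        s≡ : toℕ s ≡ μ⁻¹ w
        s≡ = toℕ-fromℕ< _
        r : Compares R (μ⁻¹ w)
        r = subst₂ R (sym (cosetMin-orbit (μ w) k)) (sym (cosetMin-cong (μ-μ⁻¹ w))) (∈side⇒ (flip R) (flip R?) t t∈)
        t≡ : ((- (+ q)) ℤ.* + toℕ s) %ℕ n ≡ w
        t≡ = trans (μ-residue (toℕ s)) (trans (cong (λ y → μ y % n) s≡)
               (trans (μ-μ⁻¹ w) (m<n⇒m%n≡m (toℕ<n t))))

    μ-changes-coset⇒splitting : (∀ x → x < n → x ≢ 0 → cosetMin x ≢ cosetMin (μ x)) →
                                GivesSplitting (- (+ q)) (q ^ 2) n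
    μ-changes-coset⇒splitting changes =
      S₁ , S₂ , side-cosets _<_ _<?_ , side-cosets _>_ _>?_ , nonzero , covers , disjoint ,
      side-maps _<_ _<?_ , side-maps _>_ _>?_
      where
      S₁ S₂ : Subset n
      S₁ = side _<_ _<?_
      S₂ = side _>_ _>?_
      cosetMin-μ0 : ∀ x → x ≡ 0 → cosetMin x ≡ cosetMin (μ x)
      cosetMin-μ0 x refl = cong cosetMin (sym (*-zeroʳ ((n ∸ 1) * q)))
      nonzero : ∀ x → x ∈ S₁ ⊎ x ∈ S₂ → toℕ x ≢ 0
      nonzero x (inj₁ x∈S₁) x≡0 = <-irrefl (cosetMin-μ0 (toℕ x) x≡0) (∈side⇒ _<_ _<?_ x x∈S₁)
      nonzero x (inj₂ x∈S₂) x≡0 = <-irrefl (sym (cosetMin-μ0 (toℕ x) x≡0)) (∈side⇒ _>_ _>?_ x x∈S₂)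
      covers : ∀ x → toℕ x ≢ 0 → x ∈ S₁ ⊎ x ∈ S₂
      covers x x≢0 with <-cmp (cosetMin (toℕ x)) (cosetMin (μ (toℕ x)))
      ... | tri< lt _ _ = inj₁ (⇒∈side _<_ _<?_ x lt)
      ... | tri≈ _ eq _ = ⊥-elim (changes (toℕ x) (toℕ<n x) x≢0 eq)
      ... | tri> _ _ gt = inj₂ (⇒∈side _>_ _>?_ x gt)
      disjoint : ∀ x → x ∈ S₁ → x ∈ S₂ → ⊥
      disjoint x x∈S₁ x∈S₂ = <-asym (∈side⇒ _<_ _<?_ x x∈S₁) (∈side⇒ _>_ _>?_ x x∈S₂)

  gcd≡1⇒splitting : Coprime n q → (∀ i → 1 ≤ i → gcd n (q ^ (2 * i ∸ 1) + 1) ≡ 1) →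
                    GivesSplitting (- (+ q)) (q ^ 2) n
  gcd≡1⇒splitting n⊥q gcd≡1 with coprime⇒invertible n⊥q
  ... | u , uq≈1 with invertible⇒periodic {u ^ 2} {q ^ 2} (invertible-^ {u} {q} uq≈1 2)
  ...   | k , q²-period = μ-changes-coset⇒splitting k q²-period (gcd≡1⇒μ-changes-coset k q²-period gcd≡1)

corollary5p6 : (q n : ℕ) .{{_ : NonZero n}} → PrimePower q → n % 2 ≡ 1 → Coprime n q →
    (GivesSplitting (- (+ q)) (q ^ 2) n ⇔ (∀ (i : ℕ) → 1 ≤ i → gcd n (q ^ (2 * i ∸ 1) + 1) ≡ 1))
corollary5p6 q n _ _ n⊥q = mk⇔ splitting⇒gcd≡1 (gcd≡1⇒splitting n⊥q)
  where open Multiplier q n
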